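{- Let $G$ be a graph and let $W\subseteq V(G)$. Then $$\phi(A(S_G-W),x)=x^{|E(G)|-|V(G)|+|W|}\,\phi(Q(G)_{[G-W]},x^2).$$
   Context: All graphs are finite, undirected, without loops or multiple edges. $\phi(M,x)=\det(xI-M)$ is the characteristic polynomial of a square matrix $M$ (equal to $1$ for the empty matrix). $A(G)$ is the adjacency matrix. $Q(G)=D(G)+A(G)$ is the signless Laplacian matrix, where $D(G)$ is the diagonal matrix of vertex degrees. $Q(G)_{[G-W]}$ is the principal submatrix of $Q(G)$ indexed by $V(G)\setminus W$. The subdivision graph $S_G$ is obtained by inserting into each edge $\{u,v\}$ of $G$ a new vertex of degree $2$ adjacent to $u$ and $v$; its vertex set is $V(G)\cup E(G)$, and $S_G-W$ is obtained by deleting the vertices of $W\subseteq V(G)$. -}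

module Defs where

open import Data.Nat as ℕ using (ℕ; zero; suc)
open import Data.Integer using (ℤ; _+_; _*_; _-_; -_; _^_; 0ℤ; 1ℤ)
open import Data.Fin using (Fin; zero; suc; toℕ; punchIn; _↑ˡ_; _↑ʳ_; splitAt)
open import Data.Fin.Subset using (Subset; _∈_; _∉_) renaming (∣_∣ to ∣_∣ₛ)
open import Data.Fin.Subset.Properties using (_∈?_)
open import Data.List using (List; length; lookup; map; _++_; filter; allFin)
open import Data.Product using (_×_; _,_; proj₁; proj₂)
open import Data.Sum using (_⊎_; inj₁; inj₂)
open import Data.Bool using (Bool; true; false; if_then_else_)
open import Relation.Nullary using (¬_; Dec; yes; no; does)
open import Relation.Nullary.Decidable using (⌊_⌋)
open import Relation.Binary.PropositionalEquality using (_≡_; _≢_)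
import Data.Fin.Properties as FinP

Matrix : ℕ → Set
Matrix k = Fin k → Fin k → ℤ

Σ : (k : ℕ) → (Fin k → ℤ) → ℤ
Σ zero    f = 0ℤ
Σ (suc k) f = f zero + Σ k (λ i → f (suc i))

det : (k : ℕ) → Matrix k → ℤ
det zero    M = 1ℤ
det (suc k) M =
  Σ (suc k) (λ j → ((- 1ℤ) ^ toℕ j) * (M zero j * det k (λ a b → M (suc a) (punchIn j b))))

I : (k : ℕ) → Matrix k
I k i j = if ⌊ i FinP.≟ j ⌋ then 1ℤ else 0ℤ

φ : (k : ℕ) → Matrix k → ℤ → ℤ
φ k M x = det k (λ i j → x * I k i j - M i j)

principal : {N : ℕ} → (Fin N → Fin N → ℤ) → (L : List (Fin N)) → Matrix (length L)
principal M L i j = M (lookup L i) (lookup L j)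

SameEdge : {n : ℕ} → Fin n × Fin n → Fin n × Fin n → Set
SameEdge (u , v) (u' , v') = (u ≡ u' × v ≡ v') ⊎ (u ≡ v' × v ≡ u')

record Graph : Set where
  field
    n        : ℕ
    m        : ℕ
    ends     : Fin m → Fin n × Fin n
    loopless : ∀ e → proj₁ (ends e) ≢ proj₂ (ends e)
    simple   : ∀ e f → SameEdge (ends e) (ends f) → e ≡ f
open Graph public

[_] : Bool → ℤ
[ true ]  = 1ℤ
[ false ] = 0ℤ

incident : (G : Graph) → Fin (n G) → Fin (m G) → Bool
incident G v e = ⌊ v FinP.≟ proj₁ (ends G e) ⌋ Data.Bool.∨ ⌊ v FinP.≟ proj₂ (ends G e) ⌋
  where import Data.Bool

joins : (G : Graph) → Fin (n G) → Fin (n G) → Fin (m G) → Bool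
joins G u v e = (⌊ u FinP.≟ proj₁ (ends G e) ⌋ ∧ ⌊ v FinP.≟ proj₂ (ends G e) ⌋)
              ∨ (⌊ u FinP.≟ proj₂ (ends G e) ⌋ ∧ ⌊ v FinP.≟ proj₁ (ends G e) ⌋)
  where open import Data.Bool using (_∧_; _∨_)

A : (G : Graph) → Matrix (n G)
A G u v = Σ (m G) (λ e → [ joins G u v e ])

D : (G : Graph) → Matrix (n G)
D G u v = if ⌊ u FinP.≟ v ⌋ then Σ (m G) (λ e → [ incident G u e ]) else 0ℤ

Q : (G : Graph) → Matrix (n G)
Q G u v = D G u v + A G u v

keep : {k : ℕ} → Subset k → List (Fin k)
keep W = filter (λ v → Relation.Nullary.¬? (v ∈? W)) (allFin _)
  where import Relation.Nullary

QGW : (G : Graph) (W : Subset (n G)) → Matrix (length (keep W))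
QGW G W = principal (Q G) (keep W)

-- Subdivision graph S_G: vertex set V(G) ∪ E(G) = Fin (n + m),
-- the first n indices are the original vertices, the last m the edges.

sideS : (G : Graph) → Fin (n G ℕ.+ m G) → Fin (n G) ⊎ Fin (m G)
sideS G = splitAt (n G)

AS : (G : Graph) → Matrix (n G ℕ.+ m G)
AS G a b with sideS G a | sideS G b
... | inj₁ v | inj₂ e = [ incident G v e ]
... | inj₂ e | inj₁ v = [ incident G v e ]
... | inj₁ _ | inj₁ _ = 0ℤ
... | inj₂ _ | inj₂ _ = 0ℤ

keepS : (G : Graph) → Subset (n G) → List (Fin (n G ℕ.+ m G))
keepS G W = map (_↑ˡ m G) (keep W) ++ map (n G ↑ʳ_) (allFin (m G))

ASW : (G : Graph) (W : Subset (n G)) → Matrix (length (keepS G W))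
ASW G W = principal (AS G) (keepS G W)

module Submission where

-- List the vertices of S_G − W with the k = |V(G) ∖ W| surviving vertices of G
-- first and the m = |E(G)| subdivision vertices last.  Then
-- x I − A(S_G − W) = [[x I, −R], [−Rᵀ, x I]], where R is the vertex–edge
-- incidence matrix of G restricted to V(G) ∖ W, and R Rᵀ = D + A = Q on V(G) ∖ W.
-- The Schur complement identity x^k det [[A, B], [C, x I]] = x^m det (x A − B C)
-- then turns det (x I − A(S_G − W)) into det (x² I − Q(G)_[G−W]).
--
-- The only structural property of det it needs is
-- that expanding along a row with the cofactors of another row gives 0; this
-- follows from the sign change under swapping the first two rows, which the
-- expansion along those two rows makes visible.

open import Defs
open import Data.Nat using (_∸_)
open import Data.Integer using (ℤ; _*_; _^_)
open import Data.Fin.Subset using (Subset; ∣_∣)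
open import Data.List using (length)
open import Relation.Binary.PropositionalEquality using (_≡_)

open import Data.Bool using (Bool; true; false; not; _∧_; _∨_; if_then_else_)
open import Data.Empty using (⊥; ⊥-elim)
open import Data.Fin using (Fin; zero; suc; toℕ; punchIn; punchOut; _↑ˡ_; _↑ʳ_; cast; splitAt)
import Data.Fin.Properties as Finₚ
open import Data.Fin.Subset using (∁; inside; outside)
open import Data.Fin.Subset.Properties using (_∈?_; ∣∁p∣≡n∸∣p∣)
open import Data.Integer using (_+_; _-_; -_; 0ℤ; 1ℤ; +0; +[1+_]; -[1+_])
import Data.Integer.Properties as ℤₚ
open import Data.Integer.Tactic.RingSolver using (solve-∀)
open import Data.List using (List; []; _∷_; lookup; map; _++_; filter; tabulate; allFin)
import Data.List.Properties as Listₚ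
open import Data.Nat as ℕ using (ℕ; zero; suc)
import Data.Nat.Properties as ℕₚ
import Data.Vec as Vec
open import Function using (_∘_)
open import Level using (0ℓ)
open import Relation.Binary.PropositionalEquality
  using (refl; sym; trans; cong; cong₂; _≢_; module ≡-Reasoning)
open import Relation.Nullary using (Dec; yes; no; does; ¬?)
open import Relation.Nullary.Decidable using (⌊_⌋)
open import Relation.Unary using (Pred; Decidable)

open import Algebra.Properties.Semiring.Sum ℤₚ.+-*-semiring
  using (sum; sum-syntax; sum-cong-≗; sum-replicate-zero; sum-remove; ∑-distrib-+; ∑-comm; *-distribˡ-sum)

Σ≡sum : ∀ k (f : Fin k → ℤ) → Σ k f ≡ sum f
Σ≡sum zero    f = refl
Σ≡sum (suc k) f = cong (f zero +_) (Σ≡sum k (f ∘ suc))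

sum-neg : ∀ {k} (f : Fin k → ℤ) → ∑[ i < k ] (- f i) ≡ - sum f
sum-neg {zero}  f = refl
sum-neg {suc k} f = trans (cong (- f zero +_) (sum-neg (f ∘ suc))) (sym (ℤₚ.neg-distrib-+ (f zero) _))

sum-zero : ∀ {k} (f : Fin k → ℤ) → (∀ i → f i ≡ 0ℤ) → sum f ≡ 0ℤ
sum-zero {k} f f≡0 = trans (sum-cong-≗ f≡0) (sum-replicate-zero k)

sum-single : ∀ {k} (f : Fin (suc k) → ℤ) p → (∀ j → f (punchIn p j) ≡ 0ℤ) → sum f ≡ f p
sum-single f p f≡0 = begin
  sum f                        ≡⟨ sum-remove {i = p} f ⟩
  f p + sum (f ∘ punchIn p)    ≡⟨ cong (f p +_) (sum-zero _ f≡0) ⟩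
  f p + 0ℤ                     ≡⟨ ℤₚ.+-identityʳ (f p) ⟩
  f p                          ∎
  where open ≡-Reasoning

sum-↑ : ∀ k {m} (f : Fin (k ℕ.+ m) → ℤ) → sum f ≡ ∑[ i < k ] f (i ↑ˡ m) + ∑[ e < m ] f (k ↑ʳ e)
sum-↑ zero    f = sym (ℤₚ.+-identityˡ _)
sum-↑ (suc k) f = trans (cong (f zero +_) (sum-↑ k (f ∘ suc))) (sym (ℤₚ.+-assoc (f zero) _ _))

i≡-i⇒i≡0 : ∀ (i : ℤ) → i ≡ - i → i ≡ 0ℤ
i≡-i⇒i≡0 +0         _  = refl
i≡-i⇒i≡0 +[1+ n ]   ()
i≡-i⇒i≡0 -[1+ n ]   ()

punchIn-punchOut-comm : ∀ {k} {p q : Fin (suc (suc k))} (p≢q : p ≢ q) (q≢p : q ≢ p) b →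
  punchIn p (punchIn (punchOut p≢q) b) ≡ punchIn q (punchIn (punchOut q≢p) b)
punchIn-punchOut-comm {_} {zero}  {zero}  p≢q _   _       = ⊥-elim (p≢q refl)
punchIn-punchOut-comm {_} {zero}  {suc q} _   _   _       = refl
punchIn-punchOut-comm {_} {suc p} {zero}  _   _   _       = refl
punchIn-punchOut-comm {_} {suc p} {suc q} _   _   zero    = refl
punchIn-punchOut-comm {_} {suc p} {suc q} p≢q q≢p (suc b) =
  cong suc (punchIn-punchOut-comm (p≢q ∘ cong suc) (q≢p ∘ cong suc) b)

punchIn-↑ˡ : ∀ {k} m (i : Fin (suc k)) (j : Fin k) → punchIn (i ↑ˡ m) (j ↑ˡ m) ≡ punchIn i j ↑ˡ m
punchIn-↑ˡ m zero    j       = refl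
punchIn-↑ˡ m (suc i) zero    = refl
punchIn-↑ˡ m (suc i) (suc j) = cong suc (punchIn-↑ˡ m i j)

punchIn-↑ʳ : ∀ {k} m (i : Fin (suc k)) (e : Fin m) → punchIn (i ↑ˡ m) (k ↑ʳ e) ≡ suc k ↑ʳ e
punchIn-↑ʳ         m zero    e = refl
punchIn-↑ʳ {suc k} m (suc i) e = cong suc (punchIn-↑ʳ m i e)

↑ˡ≢↑ʳ : ∀ {k m} (a : Fin k) (e : Fin m) → a ↑ˡ m ≢ k ↑ʳ e
↑ˡ≢↑ʳ {k} {m} a e a≡e
  with trans (sym (Finₚ.splitAt-↑ˡ k a m)) (trans (cong (splitAt k) a≡e) (Finₚ.splitAt-↑ʳ k m e))
... | ()

sgn : ∀ {k} → Fin k → ℤ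
sgn j = (- 1ℤ) ^ toℕ j

sgn-punchOut : ∀ {k} {p q : Fin (suc k)} (p≢q : p ≢ q) (q≢p : q ≢ p) →
  sgn p * sgn (punchOut p≢q) ≡ - (sgn q * sgn (punchOut q≢p))
sgn-punchOut {_}     {zero}  {zero}  p≢q _   = ⊥-elim (p≢q refl)
sgn-punchOut {suc k} {zero}  {suc q} _   _   = flip (sgn q)
  where
  flip : ∀ s → 1ℤ * s ≡ - ((- 1ℤ * s) * 1ℤ)
  flip = solve-∀
sgn-punchOut {suc k} {suc p} {zero}  _   _   = flip (sgn p)
  where
  flip : ∀ s → (- 1ℤ * s) * 1ℤ ≡ - (1ℤ * s)
  flip = solve-∀
sgn-punchOut {suc k} {suc p} {suc q} p≢q q≢p =
  trans (cancel (sgn p) _)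
    (trans (sgn-punchOut (p≢q ∘ cong suc) (q≢p ∘ cong suc)) (cong -_ (sym (cancel (sgn q) _))))
  where
  cancel : ∀ s t → (- 1ℤ * s) * (- 1ℤ * t) ≡ s * t
  cancel = solve-∀

sgn-↑ˡ : ∀ {k} m (i : Fin k) → sgn (i ↑ˡ m) ≡ sgn i
sgn-↑ˡ m i = cong ((- 1ℤ) ^_) (Finₚ.toℕ-↑ˡ i m)

minor : ∀ {k} → Matrix (suc k) → Fin (suc k) → Matrix k
minor M j a b = M (suc a) (punchIn j b)

laplace : ∀ {k} → Matrix (suc k) → (Fin (suc k) → ℤ) → ℤ
laplace {k} M v = ∑[ j < suc k ] (sgn j * (v j * det k (minor M j)))

det-laplace : ∀ {k} (M : Matrix (suc k)) → det (suc k) M ≡ laplace M (M zero)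
det-laplace {k} M = Σ≡sum (suc k) (λ j → sgn j * (M zero j * det k (minor M j)))

det-cong : ∀ k {M N : Matrix k} → (∀ i j → M i j ≡ N i j) → det k M ≡ det k N
det-cong zero    M≡N = refl
det-cong (suc k) {M} {N} M≡N = begin
  det (suc k) M       ≡⟨ det-laplace M ⟩
  laplace M (M zero)  ≡⟨ sum-cong-≗ (λ j → cong₂ (λ a d → sgn j * (a * d)) (M≡N zero j)
                           (det-cong k (λ a b → M≡N (suc a) (punchIn j b)))) ⟩
  laplace N (N zero)  ≡⟨ det-laplace N ⟨
  det (suc k) N       ∎
  where open ≡-Reasoning

laplace-scale-sub : ∀ {k} (M : Matrix (suc k)) a (u v : Fin (suc k) → ℤ) →
  laplace M (λ c → a * u c - v c) ≡ a * laplace M u - laplace M v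
laplace-scale-sub {k} M a u v = begin
  ∑[ j < suc k ] (sgn j * ((a * u j - v j) * d j))
    ≡⟨ sum-cong-≗ (λ j → distrib a (sgn j) (u j) (v j) (d j)) ⟩
  ∑[ j < suc k ] (a * (sgn j * (u j * d j)) + - (sgn j * (v j * d j)))
    ≡⟨ ∑-distrib-+ (λ j → a * (sgn j * (u j * d j))) (λ j → - (sgn j * (v j * d j))) ⟩
  ∑[ j < suc k ] (a * (sgn j * (u j * d j))) + ∑[ j < suc k ] (- (sgn j * (v j * d j)))
    ≡⟨ cong₂ _+_ (sym (*-distribˡ-sum a (λ j → sgn j * (u j * d j))))
                 (sum-neg (λ j → sgn j * (v j * d j))) ⟩
  a * laplace M u - laplace M v ∎
  where
  open ≡-Reasoning
  d : Fin (suc k) → ℤ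
  d j = det k (minor M j)
  distrib : ∀ a s x y t → s * ((a * x - y) * t) ≡ a * (s * (x * t)) + - (s * (y * t))
  distrib = solve-∀

laplace-∑ : ∀ {k m} (M : Matrix (suc k)) (C : Fin m → ℤ) (w : Fin m → Fin (suc k) → ℤ) →
  laplace M (λ c → ∑[ e < m ] (C e * w e c)) ≡ ∑[ e < m ] (C e * laplace M (w e))
laplace-∑ {k} {m} M C w = begin
  ∑[ j < suc k ] (sgn j * (∑[ e < m ] (C e * w e j) * d j))
    ≡⟨ sum-cong-≗ (λ j → trans (pull (sgn j) (d j) _)
                                (*-distribˡ-sum (sgn j * d j) (λ e → C e * w e j))) ⟩
  ∑[ j < suc k ] ∑[ e < m ] (sgn j * d j * (C e * w e j))
    ≡⟨ ∑-comm (λ j e → sgn j * d j * (C e * w e j)) ⟩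
  ∑[ e < m ] ∑[ j < suc k ] (sgn j * d j * (C e * w e j))
    ≡⟨ sum-cong-≗ (λ e → trans (sum-cong-≗ (λ j → push (sgn j) (d j) (C e) (w e j)))
                              (sym (*-distribˡ-sum (C e) (λ j → sgn j * (w e j * d j))))) ⟩
  ∑[ e < m ] (C e * laplace M (w e)) ∎
  where
  open ≡-Reasoning
  d : Fin (suc k) → ℤ
  d j = det k (minor M j)
  pull : ∀ s t x → s * (x * t) ≡ s * t * x
  pull = solve-∀
  push : ∀ s t c x → s * t * (c * x) ≡ c * (s * (x * t))
  push = solve-∀

swapRows₀₁ : ∀ {k} → Matrix (suc (suc k)) → Matrix (suc (suc k))
swapRows₀₁ M zero          = M (suc zero)
swapRows₀₁ M (suc zero)    = M zero
swapRows₀₁ M (suc (suc i)) = M (suc (suc i))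

-- The term of the Laplace expansion along the first two rows that takes
-- column p from the first row and column q from the second.
pairTerm : ∀ {k} → Matrix (suc (suc k)) → Fin (suc (suc k)) → Fin (suc (suc k)) → ℤ
pairTerm {k} M p q with p Finₚ.≟ q
... | yes _   = 0ℤ
... | no p≢q = (sgn p * sgn (punchOut p≢q)) * ((M zero p * M (suc zero) q)
                 * det k (λ a b → M (suc (suc a)) (punchIn p (punchIn (punchOut p≢q) b))))

pairTerm-diag : ∀ {k} (M : Matrix (suc (suc k))) p → pairTerm M p p ≡ 0ℤ
pairTerm-diag M p with p Finₚ.≟ p
... | yes _   = refl
... | no p≢p = ⊥-elim (p≢p refl)

pairTerm-punchIn : ∀ {k} (M : Matrix (suc (suc k))) p l →
  pairTerm M p (punchIn p l)
    ≡ (sgn p * sgn l) * ((M zero p * M (suc zero) (punchIn p l)) * det k (minor (minor M p) l))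
pairTerm-punchIn M p l with p Finₚ.≟ punchIn p l
... | yes p≡p[l] = ⊥-elim (Finₚ.punchInᵢ≢i p l (sym p≡p[l]))
... | no p≢p[l] = cong (λ l′ → (sgn p * sgn l′) * ((M zero p * M (suc zero) (punchIn p l))
                                * det _ (λ a b → M (suc (suc a)) (punchIn p (punchIn l′ b)))))
                         (trans (Finₚ.punchOut-cong p refl) (Finₚ.punchOut-punchIn p))

pairTerm-swap : ∀ {k} (M : Matrix (suc (suc k))) p q → pairTerm (swapRows₀₁ M) p q ≡ - pairTerm M q p
pairTerm-swap {k} M p q with p Finₚ.≟ q | q Finₚ.≟ p
... | yes _    | yes _    = refl
... | yes p≡q  | no q≢p   = ⊥-elim (q≢p (sym p≡q))
... | no p≢q   | yes q≡p  = ⊥-elim (p≢q (sym q≡p))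
... | no p≢q   | no q≢p   = begin
  (sgn p * sgn (punchOut p≢q)) * ((M (suc zero) p * M zero q) * rest p≢q)
    ≡⟨ cong₂ (λ s d → s * ((M (suc zero) p * M zero q) * d)) (sgn-punchOut p≢q q≢p)
             (det-cong k (λ a b → cong (M (suc (suc a))) (punchIn-punchOut-comm p≢q q≢p b))) ⟩
  - (sgn q * sgn (punchOut q≢p)) * ((M (suc zero) p * M zero q) * rest q≢p)
    ≡⟨ reorder (sgn q * sgn (punchOut q≢p)) (M (suc zero) p) (M zero q) (rest q≢p) ⟩
  - ((sgn q * sgn (punchOut q≢p)) * ((M zero q * M (suc zero) p) * rest q≢p)) ∎
  where
  open ≡-Reasoning
  rest : ∀ {i j} → i ≢ j → ℤ
  rest {i} i≢j = det k (λ a b → M (suc (suc a)) (punchIn i (punchIn (punchOut i≢j) b)))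
  reorder : ∀ s x y d → - s * ((x * y) * d) ≡ - (s * ((y * x) * d))
  reorder = solve-∀

det-pairTerms : ∀ {k} (M : Matrix (suc (suc k))) →
  det (suc (suc k)) M ≡ ∑[ p < suc (suc k) ] ∑[ q < suc (suc k) ] pairTerm M p q
det-pairTerms {k} M = trans (det-laplace M) (sum-cong-≗ row) where
  open ≡-Reasoning
  row : ∀ p → sgn p * (M zero p * det (suc k) (minor M p)) ≡ ∑[ q < suc (suc k) ] pairTerm M p q
  row p = begin
    sgn p * (M zero p * det (suc k) (minor M p))
      ≡⟨ cong (λ d → sgn p * (M zero p * d)) (det-laplace (minor M p)) ⟩
    sgn p * (M zero p * ∑[ l < suc k ] t l)
      ≡⟨ assoc (sgn p) (M zero p) _ ⟩
    sgn p * M zero p * ∑[ l < suc k ] t l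
      ≡⟨ *-distribˡ-sum (sgn p * M zero p) t ⟩
    ∑[ l < suc k ] (sgn p * M zero p * t l)
      ≡⟨ sum-cong-≗ (λ l → trans (regroup (sgn p) (sgn l) (M zero p) (M (suc zero) (punchIn p l)) _)
                                 (sym (pairTerm-punchIn M p l))) ⟩
    ∑[ l < suc k ] pairTerm M p (punchIn p l)
      ≡⟨ sym (ℤₚ.+-identityˡ _) ⟩
    0ℤ + ∑[ l < suc k ] pairTerm M p (punchIn p l)
      ≡⟨ cong (_+ ∑[ l < suc k ] pairTerm M p (punchIn p l)) (sym (pairTerm-diag M p)) ⟩
    pairTerm M p p + ∑[ l < suc k ] pairTerm M p (punchIn p l)
      ≡⟨ sum-remove {i = p} (pairTerm M p) ⟨
    ∑[ q < suc (suc k) ] pairTerm M p q ∎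
    where
    t : Fin (suc k) → ℤ
    t l = sgn l * (M (suc zero) (punchIn p l) * det k (minor (minor M p) l))
    assoc : ∀ s x y → s * (x * y) ≡ s * x * y
    assoc = solve-∀
    regroup : ∀ s s′ x y d → s * x * (s′ * (y * d)) ≡ (s * s′) * ((x * y) * d)
    regroup = solve-∀

det-swapRows₀₁ : ∀ {k} (M : Matrix (suc (suc k))) → det (suc (suc k)) (swapRows₀₁ M) ≡ - det (suc (suc k)) M
det-swapRows₀₁ {k} M = begin
  det K (swapRows₀₁ M)                     ≡⟨ det-pairTerms (swapRows₀₁ M) ⟩
  ∑[ p < K ] ∑[ q < K ] pairTerm (swapRows₀₁ M) p q
    ≡⟨ sum-cong-≗ (λ p → trans (sum-cong-≗ (pairTerm-swap M p)) (sum-neg (λ q → pairTerm M q p))) ⟩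
  ∑[ p < K ] (- ∑[ q < K ] pairTerm M q p) ≡⟨ sum-neg (λ p → ∑[ q < K ] pairTerm M q p) ⟩
  - ∑[ p < K ] ∑[ q < K ] pairTerm M q p   ≡⟨ cong -_ (∑-comm (λ p q → pairTerm M q p)) ⟩
  - ∑[ q < K ] ∑[ p < K ] pairTerm M q p   ≡⟨ cong -_ (det-pairTerms M) ⟨
  - det K M                                ∎
  where
  open ≡-Reasoning
  K = suc (suc k)

det-repeatedRow₀ : ∀ {k} (M : Matrix (suc k)) (j : Fin k) →
  (∀ c → M zero c ≡ M (suc j) c) → det (suc k) M ≡ 0ℤ
det-repeatedRow₀ {suc k} M zero M₀≡M₁ =
  i≡-i⇒i≡0 _ (trans (det-cong (suc (suc k)) swap≗) (det-swapRows₀₁ M))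
  where
  swap≗ : ∀ i c → M i c ≡ swapRows₀₁ M i c
  swap≗ zero          c = M₀≡M₁ c
  swap≗ (suc zero)    c = sym (M₀≡M₁ c)
  swap≗ (suc (suc i)) c = refl
-- After swapping the first two rows, every minor along the first row again
-- repeats its first row, one position earlier.
det-repeatedRow₀ {suc k} M (suc j) M₀≡Mⱼ = begin
  det (suc (suc k)) M                      ≡⟨ ℤₚ.neg-involutive _ ⟨
  - - det (suc (suc k)) M                  ≡⟨ cong -_ (det-swapRows₀₁ M) ⟨
  - det (suc (suc k)) (swapRows₀₁ M)       ≡⟨ cong -_ (det-laplace (swapRows₀₁ M)) ⟩
  - laplace (swapRows₀₁ M) (M (suc zero))  ≡⟨ cong -_ (sum-zero _ vanish) ⟩
  - 0ℤ                                     ≡⟨⟩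
  0ℤ                                       ∎
  where
  open ≡-Reasoning
  vanish : ∀ c → sgn c * (M (suc zero) c * det (suc k) (minor (swapRows₀₁ M) c)) ≡ 0ℤ
  vanish c = trans (cong (λ d → sgn c * (M (suc zero) c * d))
                     (det-repeatedRow₀ (minor (swapRows₀₁ M) c) j (M₀≡Mⱼ ∘ punchIn c)))
                   (zeroʳ (sgn c) (M (suc zero) c))
    where
    zeroʳ : ∀ s x → s * (x * 0ℤ) ≡ 0ℤ
    zeroʳ = solve-∀

withFirstRow : ∀ {k} → Matrix (suc k) → (Fin (suc k) → ℤ) → Matrix (suc k)
withFirstRow M v zero    = v
withFirstRow M v (suc i) = M (suc i)

laplace-alienRow : ∀ {k} (M : Matrix (suc k)) (i : Fin k) → laplace M (M (suc i)) ≡ 0ℤ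
laplace-alienRow M i = trans (sym (det-laplace (withFirstRow M (M (suc i)))))
                             (det-repeatedRow₀ (withFirstRow M (M (suc i))) i (λ c → refl))

laplace-rowReduce : ∀ {k m} (M : Matrix (suc k)) x (B : Fin m → ℤ) (ρ : Fin m → Fin k) →
  laplace M (λ c → x * M zero c - ∑[ e < m ] (B e * M (suc (ρ e)) c)) ≡ x * det (suc k) M
laplace-rowReduce {k} {m} M x B ρ = begin
  laplace M (λ c → x * M zero c - ∑[ e < m ] (B e * M (suc (ρ e)) c))
    ≡⟨ laplace-scale-sub M x (M zero) (λ c → ∑[ e < m ] (B e * M (suc (ρ e)) c)) ⟩
  x * laplace M (M zero) - laplace M (λ c → ∑[ e < m ] (B e * M (suc (ρ e)) c))
    ≡⟨ cong₂ (λ d s → x * d - s) (sym (det-laplace M)) (laplace-∑ M B (λ e → M (suc (ρ e)))) ⟩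
  x * det (suc k) M - ∑[ e < m ] (B e * laplace M (M (suc (ρ e))))
    ≡⟨ cong (_-_ (x * det (suc k) M)) (sum-zero (λ e → B e * laplace M (M (suc (ρ e))))
          (λ e → trans (cong (B e *_) (laplace-alienRow M (ρ e))) (ℤₚ.*-zeroʳ (B e)))) ⟩
  x * det (suc k) M - 0ℤ
    ≡⟨ ℤₚ.+-identityʳ _ ⟩
  x * det (suc k) M ∎
  where open ≡-Reasoning

I-≡ : ∀ {a b} {i j : Fin a} {i′ j′ : Fin b} → (i ≡ j → i′ ≡ j′) → (i′ ≡ j′ → i ≡ j) → I a i j ≡ I b i′ j′
I-≡ {i = i} {j} {i′} {j′} to from with i Finₚ.≟ j | i′ Finₚ.≟ j′
... | yes _    | yes _     = refl
... | no _     | no _      = refl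
... | yes i≡j  | no i′≢j′  = ⊥-elim (i′≢j′ (to i≡j))
... | no i≢j   | yes i′≡j′ = ⊥-elim (i≢j (from i′≡j′))

I-diag : ∀ {a} (i : Fin a) → I a i i ≡ 1ℤ
I-diag i with i Finₚ.≟ i
... | yes _   = refl
... | no i≢i = ⊥-elim (i≢i refl)

I-off : ∀ {a} {i j : Fin a} → i ≢ j → I a i j ≡ 0ℤ
I-off {i = i} {j} i≢j with i Finₚ.≟ j
... | yes i≡j = ⊥-elim (i≢j i≡j)
... | no _    = refl

sum-*-I : ∀ {m} (f : Fin m → ℤ) j → ∑[ e < m ] (f e * I m e j) ≡ f j
sum-*-I {suc m} f j = begin
  ∑[ e < suc m ] (f e * I (suc m) e j)
    ≡⟨ sum-single (λ e → f e * I (suc m) e j) j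
         (λ l → trans (cong (f (punchIn j l) *_) (I-off (Finₚ.punchInᵢ≢i j l))) (ℤₚ.*-zeroʳ (f (punchIn j l)))) ⟩
  f j * I (suc m) j j  ≡⟨ cong (f j *_) (I-diag j) ⟩
  f j * 1ℤ             ≡⟨ ℤₚ.*-identityʳ (f j) ⟩
  f j                  ∎
  where open ≡-Reasoning

det-scalar : ∀ k x → det k (λ i j → x * I k i j) ≡ x ^ k
det-scalar zero    x = refl
det-scalar (suc k) x = begin
  det (suc k) xI             ≡⟨ det-laplace xI ⟩
  laplace xI (xI zero)       ≡⟨ sum-single (λ j → sgn j * (xI zero j * det k (minor xI j))) zero offDiagonal ⟩
  1ℤ * (x * 1ℤ * det k (minor xI zero))
    ≡⟨ cong (λ d → 1ℤ * (x * 1ℤ * d))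
         (trans (det-cong k (λ a b → cong (x *_) (I-≡ Finₚ.suc-injective (cong suc)))) (det-scalar k x)) ⟩
  1ℤ * (x * 1ℤ * x ^ k)      ≡⟨ simplify x (x ^ k) ⟩
  x ^ suc k                  ∎
  where
  open ≡-Reasoning
  xI : Matrix (suc k)
  xI i j = x * I (suc k) i j
  simplify : ∀ x y → 1ℤ * (x * 1ℤ * y) ≡ x * y
  simplify = solve-∀
  offDiagonal : ∀ l → sgn (suc l) * (x * 0ℤ * det k (minor xI (suc l))) ≡ 0ℤ
  offDiagonal l = vanish (sgn (suc l)) x (det k (minor xI (suc l)))
    where
    vanish : ∀ s x d → s * (x * 0ℤ * d) ≡ 0ℤ
    vanish = solve-∀

I-↑ˡ : ∀ {k} m (a b : Fin k) → I (k ℕ.+ m) (a ↑ˡ m) (b ↑ˡ m) ≡ I k a b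
I-↑ˡ m a b = I-≡ (Finₚ.↑ˡ-injective m a b) (cong (_↑ˡ m))

I-↑ʳ : ∀ k {m} (e f : Fin m) → I (k ℕ.+ m) (k ↑ʳ e) (k ↑ʳ f) ≡ I m e f
I-↑ʳ k e f = I-≡ (Finₚ.↑ʳ-injective k e f) (cong (k ↑ʳ_))

φ-cast : ∀ {a b} (e : b ≡ a) (M : Matrix a) x → φ a M x ≡ φ b (λ i j → M (cast e i) (cast e j)) x
φ-cast {a} refl M x = det-cong a (λ i j → cong₂ (λ i′ j′ → x * I a i j - M i′ j′)
                                               (sym (Finₚ.cast-is-id refl i)) (sym (Finₚ.cast-is-id refl j)))

-- For N = [[A, B], [C, x I]] this is x A − B C.
schurComplement : ∀ k m → ℤ → Matrix (k ℕ.+ m) → Matrix k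
schurComplement k m x N a b =
  x * N (a ↑ˡ m) (b ↑ˡ m) - ∑[ e < m ] (N (a ↑ˡ m) (k ↑ʳ e) * N (k ↑ʳ e) (b ↑ˡ m))

schurComplement-minor : ∀ {k m} x (N : Matrix (suc k ℕ.+ m)) b a c →
  schurComplement k m x (minor N (b ↑ˡ m)) a c ≡ minor (schurComplement (suc k) m x N) b a c
schurComplement-minor {k} {m} x N b a c =
  cong₂ (λ t s → x * t - s) (cong (N (suc a ↑ˡ m)) (punchIn-↑ˡ m b c))
    (sum-cong-≗ (λ e → cong₂ _*_ (cong (N (suc a ↑ˡ m)) (punchIn-↑ʳ m b e))
                                 (cong (N (suc k ↑ʳ e)) (punchIn-↑ˡ m b c))))

-- Scale the first row by x and subtract the B-combination of the last m rows:
-- this clears the first row of B, so the expansion along it only meets the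
-- first row of the Schur complement, and each minor is again of the same shape.
det-schur : ∀ k m x (N : Matrix (k ℕ.+ m)) → (∀ e f → N (k ↑ʳ e) (k ↑ʳ f) ≡ x * I m e f) →
  x ^ k * det (k ℕ.+ m) N ≡ x ^ m * det k (schurComplement k m x N)
det-schur zero m x N bottom = begin
  1ℤ * det m N   ≡⟨ ℤₚ.*-identityˡ _ ⟩
  det m N        ≡⟨ trans (det-cong m bottom) (det-scalar m x) ⟩
  x ^ m          ≡⟨ ℤₚ.*-identityʳ _ ⟨
  x ^ m * 1ℤ     ∎
  where open ≡-Reasoning
det-schur (suc k) m x N bottom = begin
  x ^ suc k * det K N
    ≡⟨ rearrange x (x ^ k) (det K N) ⟩
  x ^ k * (x * det K N)
    ≡⟨ cong (x ^ k *_) (laplace-rowReduce N x B (k ↑ʳ_)) ⟨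
  x ^ k * laplace N r
    ≡⟨ cong (x ^ k *_) (sum-↑ (suc k) term) ⟩
  x ^ k * (∑[ b < suc k ] term (b ↑ˡ m) + ∑[ e < m ] term (suc k ↑ʳ e))
    ≡⟨ cong (λ s → x ^ k * (∑[ b < suc k ] term (b ↑ˡ m) + s))
            (sum-zero (λ e → term (suc k ↑ʳ e)) rightVanishes) ⟩
  x ^ k * (∑[ b < suc k ] term (b ↑ˡ m) + 0ℤ)
    ≡⟨ cong (x ^ k *_) (ℤₚ.+-identityʳ _) ⟩
  x ^ k * ∑[ b < suc k ] term (b ↑ˡ m)
    ≡⟨ *-distribˡ-sum (x ^ k) (λ b → term (b ↑ˡ m)) ⟩
  ∑[ b < suc k ] (x ^ k * term (b ↑ˡ m))
    ≡⟨ sum-cong-≗ column ⟩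
  ∑[ b < suc k ] (x ^ m * (sgn b * (S zero b * det k (minor S b))))
    ≡⟨ *-distribˡ-sum (x ^ m) (λ b → sgn b * (S zero b * det k (minor S b))) ⟨
  x ^ m * laplace S (S zero)
    ≡⟨ cong (x ^ m *_) (det-laplace S) ⟨
  x ^ m * det (suc k) S ∎
  where
  open ≡-Reasoning
  K = suc k ℕ.+ m
  S = schurComplement (suc k) m x N
  B : Fin m → ℤ
  B e = N zero (suc k ↑ʳ e)
  r : Fin K → ℤ
  r c = x * N zero c - ∑[ e < m ] (B e * N (suc k ↑ʳ e) c)
  term : Fin K → ℤ
  term j = sgn j * (r j * det (k ℕ.+ m) (minor N j))
  rightVanishes : ∀ f → term (suc k ↑ʳ f) ≡ 0ℤ
  rightVanishes f = begin
    sgn (suc k ↑ʳ f) * ((x * B f - ∑[ e < m ] (B e * N (suc k ↑ʳ e) (suc k ↑ʳ f))) * d)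
      ≡⟨ cong (λ s → sgn (suc k ↑ʳ f) * ((x * B f - s) * d))
           (trans (sum-cong-≗ (λ e → trans (cong (B e *_) (bottom e f)) (sym (ℤₚ.*-assoc (B e) x _))))
                  (sum-*-I (λ e → B e * x) f)) ⟩
    sgn (suc k ↑ʳ f) * ((x * B f - B f * x) * d)
      ≡⟨ cancel (sgn (suc k ↑ʳ f)) x (B f) d ⟩
    0ℤ ∎
    where
    d = det (k ℕ.+ m) (minor N (suc k ↑ʳ f))
    cancel : ∀ s x b d → s * ((x * b - b * x) * d) ≡ 0ℤ
    cancel = solve-∀
  minorBottom : ∀ b e f → minor N (b ↑ˡ m) (k ↑ʳ e) (k ↑ʳ f) ≡ x * I m e f
  minorBottom b e f = trans (cong (N (suc k ↑ʳ e)) (punchIn-↑ʳ m b f)) (bottom e f)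
  column : ∀ b → x ^ k * term (b ↑ˡ m) ≡ x ^ m * (sgn b * (S zero b * det k (minor S b)))
  column b = begin
    x ^ k * (sgn (b ↑ˡ m) * (S zero b * det (k ℕ.+ m) (minor N (b ↑ˡ m))))
      ≡⟨ inward (x ^ k) (sgn (b ↑ˡ m)) (S zero b) _ ⟩
    sgn (b ↑ˡ m) * (S zero b * (x ^ k * det (k ℕ.+ m) (minor N (b ↑ˡ m))))
      ≡⟨ cong₂ (λ s t → s * (S zero b * t)) (sgn-↑ˡ m b)
           (trans (det-schur k m x (minor N (b ↑ˡ m)) (minorBottom b))
                  (cong (x ^ m *_) (det-cong k (schurComplement-minor x N b)))) ⟩
    sgn b * (S zero b * (x ^ m * det k (minor S b)))
      ≡⟨ inward (x ^ m) (sgn b) (S zero b) _ ⟨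
    x ^ m * (sgn b * (S zero b * det k (minor S b))) ∎
    where
    inward : ∀ y s a d → y * (s * (a * d)) ≡ s * (a * (y * d))
    inward = solve-∀
  rearrange : ∀ x y d → x * y * d ≡ y * (x * d)
  rearrange = solve-∀

-- aᵢ (resp. bᵢ) records whether u (resp. v) is the i-th end of an edge.
ends-square : ∀ a₁ a₂ → a₁ ∧ a₂ ≡ false → [ a₁ ∨ a₂ ] + [ a₁ ∧ a₂ ∨ a₂ ∧ a₁ ] ≡ [ a₁ ∨ a₂ ] * [ a₁ ∨ a₂ ]
ends-square true  true  ()
ends-square true  false _ = refl
ends-square false true  _ = refl
ends-square false false _ = refl

ends-product : ∀ a₁ a₂ b₁ b₂ → a₁ ∧ a₂ ≡ false → b₁ ∧ b₂ ≡ false → a₁ ∧ b₁ ≡ false → a₂ ∧ b₂ ≡ false →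
  [ a₁ ∧ b₂ ∨ a₂ ∧ b₁ ] ≡ [ a₁ ∨ a₂ ] * [ b₁ ∨ b₂ ]
ends-product true  true  _     _     ()   _    _    _
ends-product true  false true  _     _    _    ()   _
ends-product true  false false true  _    _    _    _  = refl
ends-product true  false false false _    _    _    _  = refl
ends-product false true  true  true  _    ()   _    _
ends-product false true  true  false _    _    _    _  = refl
ends-product false true  false true  _    _    _    ()
ends-product false true  false false _    _    _    _  = refl
ends-product false false true  true  _    _    _    _  = refl
ends-product false false true  false _    _    _    _  = refl
ends-product false false false true  _    _    _    _  = refl
ends-product false false false false _    _    _    _  = refl

⌊⌋-∧-exclusive : ∀ {P Q : Set} (P? : Dec P) (Q? : Dec Q) → (P → Q → ⊥) → ⌊ P? ⌋ ∧ ⌊ Q? ⌋ ≡ false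
⌊⌋-∧-exclusive (yes p) (yes q) ¬pq = ⊥-elim (¬pq p q)
⌊⌋-∧-exclusive (yes _) (no _)  _   = refl
⌊⌋-∧-exclusive (no _)  _       _   = refl

_≟ᵇ_ : ∀ {N} → Fin N → Fin N → Bool
u ≟ᵇ p = ⌊ u Finₚ.≟ p ⌋

ends-exclusive : ∀ {N} {p₁ p₂ : Fin N} → p₁ ≢ p₂ → ∀ w → (w ≟ᵇ p₁) ∧ (w ≟ᵇ p₂) ≡ false
ends-exclusive p₁≢p₂ w =
  ⌊⌋-∧-exclusive (w Finₚ.≟ _) (w Finₚ.≟ _) (λ w≡p₁ w≡p₂ → p₁≢p₂ (trans (sym w≡p₁) w≡p₂))

ends-incidence : ∀ {N} {p₁ p₂ : Fin N} → p₁ ≢ p₂ → ∀ u v →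
  (if u ≟ᵇ v then [ u ≟ᵇ p₁ ∨ u ≟ᵇ p₂ ] else 0ℤ) + [ (u ≟ᵇ p₁) ∧ (v ≟ᵇ p₂) ∨ (u ≟ᵇ p₂) ∧ (v ≟ᵇ p₁) ]
    ≡ [ u ≟ᵇ p₁ ∨ u ≟ᵇ p₂ ] * [ v ≟ᵇ p₁ ∨ v ≟ᵇ p₂ ]
ends-incidence {p₁ = p₁} {p₂} p₁≢p₂ u v with u Finₚ.≟ v
... | yes refl = ends-square (u ≟ᵇ p₁) (u ≟ᵇ p₂) (ends-exclusive p₁≢p₂ u)
... | no u≢v = trans (ℤₚ.+-identityˡ _)
                 (ends-product (u ≟ᵇ p₁) (u ≟ᵇ p₂) (v ≟ᵇ p₁) (v ≟ᵇ p₂)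
                   (ends-exclusive p₁≢p₂ u) (ends-exclusive p₁≢p₂ v) (distinct p₁) (distinct p₂))
  where
  distinct : ∀ p → (u ≟ᵇ p) ∧ (v ≟ᵇ p) ≡ false
  distinct p = ⌊⌋-∧-exclusive (u Finₚ.≟ p) (v Finₚ.≟ p) (λ u≡p v≡p → u≢v (trans u≡p (sym v≡p)))

Q-incidence : ∀ G (u v : Fin (n G)) → Q G u v ≡ ∑[ e < m G ] ([ incident G u e ] * [ incident G v e ])
Q-incidence G u v = begin
  D G u v + A G u v
    ≡⟨ cong₂ _+_ degree (Σ≡sum (m G) _) ⟩
  ∑[ e < m G ] degreeTerm e + ∑[ e < m G ] [ joins G u v e ]
    ≡⟨ ∑-distrib-+ degreeTerm (λ e → [ joins G u v e ]) ⟨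
  ∑[ e < m G ] (degreeTerm e + [ joins G u v e ])
    ≡⟨ sum-cong-≗ (λ e → ends-incidence (loopless G e) u v) ⟩
  ∑[ e < m G ] ([ incident G u e ] * [ incident G v e ]) ∎
  where
  open ≡-Reasoning
  degreeTerm : Fin (m G) → ℤ
  degreeTerm e = if ⌊ u Finₚ.≟ v ⌋ then [ incident G u e ] else 0ℤ
  degree : D G u v ≡ sum degreeTerm
  degree with ⌊ u Finₚ.≟ v ⌋
  ... | true  = Σ≡sum (m G) _
  ... | false = sym (sum-replicate-zero (m G))

AS-vv : ∀ G u v → AS G (u ↑ˡ m G) (v ↑ˡ m G) ≡ 0ℤ
AS-vv G u v rewrite Finₚ.splitAt-↑ˡ (n G) u (m G) | Finₚ.splitAt-↑ˡ (n G) v (m G) = refl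

AS-ve : ∀ G u e → AS G (u ↑ˡ m G) (n G ↑ʳ e) ≡ [ incident G u e ]
AS-ve G u e rewrite Finₚ.splitAt-↑ˡ (n G) u (m G) | Finₚ.splitAt-↑ʳ (n G) (m G) e = refl

AS-ev : ∀ G e u → AS G (n G ↑ʳ e) (u ↑ˡ m G) ≡ [ incident G u e ]
AS-ev G e u rewrite Finₚ.splitAt-↑ˡ (n G) u (m G) | Finₚ.splitAt-↑ʳ (n G) (m G) e = refl

AS-ee : ∀ G e f → AS G (n G ↑ʳ e) (n G ↑ʳ f) ≡ 0ℤ
AS-ee G e f rewrite Finₚ.splitAt-↑ʳ (n G) (m G) e | Finₚ.splitAt-↑ʳ (n G) (m G) f = refl

length-filter-tabulate : ∀ {n} (W : Subset n) {A : Set} (g : Fin n → A) {P : Pred A 0ℓ} (P? : Decidable P) →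
  (∀ v → does (P? (g v)) ≡ not (does (v ∈? W))) → length (filter P? (tabulate g)) ≡ ∣ ∁ W ∣
length-filter-tabulate Vec.[]            g P? _ = refl
length-filter-tabulate (inside Vec.∷ W)  g P? h with does (P? (g zero)) | h zero
... | false | _ = length-filter-tabulate W (g ∘ suc) P? (h ∘ suc)
length-filter-tabulate (outside Vec.∷ W) g P? h with does (P? (g zero)) | h zero
... | true  | _ = cong suc (length-filter-tabulate W (g ∘ suc) P? (h ∘ suc))

length-keep : ∀ {n} (W : Subset n) → length (keep W) ≡ n ∸ ∣ W ∣
length-keep W =
  trans (length-filter-tabulate W (λ v → v) (λ v → ¬? (v ∈? W)) (λ v → refl)) (∣∁p∣≡n∸∣p∣ W)

module _ {A B C : Set} (f : A → C) (g : B → C) where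

  lookup-map : ∀ (ys : List B) {L} (j : Fin L) (p : length (map g ys) ≡ L) (q : length ys ≡ L) →
    lookup (map g ys) (cast (sym p) j) ≡ g (lookup ys (cast (sym q) j))
  lookup-map (y ∷ ys) {suc L} zero    p q = refl
  lookup-map (y ∷ ys) {suc L} (suc j) p q = lookup-map ys j (ℕₚ.suc-injective p) (ℕₚ.suc-injective q)

  lookup-map-++-↑ˡ : ∀ (xs : List A) (ys : List B) {L} (i : Fin (length xs))
    (p : length (map f xs ++ map g ys) ≡ length xs ℕ.+ L) →
    lookup (map f xs ++ map g ys) (cast (sym p) (i ↑ˡ L)) ≡ f (lookup xs i)
  lookup-map-++-↑ˡ (x ∷ xs) ys zero    p = refl
  lookup-map-++-↑ˡ (x ∷ xs) ys (suc i) p = lookup-map-++-↑ˡ xs ys i (ℕₚ.suc-injective p)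

  lookup-map-++-↑ʳ : ∀ (xs : List A) (ys : List B) {L} (j : Fin L)
    (p : length (map f xs ++ map g ys) ≡ length xs ℕ.+ L) (q : length ys ≡ L) →
    lookup (map f xs ++ map g ys) (cast (sym p) (length xs ↑ʳ j)) ≡ g (lookup ys (cast (sym q) j))
  lookup-map-++-↑ʳ []       ys j p q = lookup-map ys j p q
  lookup-map-++-↑ʳ (x ∷ xs) ys j p q = lookup-map-++-↑ʳ xs ys j (ℕₚ.suc-injective p) q

module SubdivisionBlocks (G : Graph) (W : Subset (n G)) (x : ℤ) where

  k : ℕ
  k = length (keep W)

  length-keepS : length (keepS G W) ≡ k ℕ.+ m G
  length-keepS = trans (Listₚ.length-++ (map (_↑ˡ m G) (keep W)))
    (cong₂ ℕ._+_ (Listₚ.length-map (_↑ˡ m G) (keep W))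
                 (trans (Listₚ.length-map (n G ↑ʳ_) (allFin (m G))) (Listₚ.length-tabulate (λ e → e))))

  vertex : Fin k → Fin (n G)
  vertex = lookup (keep W)

  position : Fin (k ℕ.+ m G) → Fin (n G ℕ.+ m G)
  position i = lookup (keepS G W) (cast (sym length-keepS) i)

  position-↑ˡ : ∀ a → position (a ↑ˡ m G) ≡ vertex a ↑ˡ m G
  position-↑ˡ a = lookup-map-++-↑ˡ (_↑ˡ m G) (n G ↑ʳ_) (keep W) (allFin (m G)) a length-keepS

  position-↑ʳ : ∀ e → position (k ↑ʳ e) ≡ n G ↑ʳ e
  position-↑ʳ e = trans (lookup-map-++-↑ʳ (_↑ˡ m G) (n G ↑ʳ_) (keep W) (allFin (m G)) e length-keepS
                           (Listₚ.length-tabulate (λ e → e)))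
                        (cong (n G ↑ʳ_) (Listₚ.lookup-tabulate (λ e → e) e))

  N : Matrix (k ℕ.+ m G)
  N i j = x * I (k ℕ.+ m G) i j - AS G (position i) (position j)

  N-vv : ∀ a b → N (a ↑ˡ m G) (b ↑ˡ m G) ≡ x * I k a b
  N-vv a b = trans (cong₂ (λ c t → x * c - t) (I-↑ˡ (m G) a b)
                     (trans (cong₂ (AS G) (position-↑ˡ a) (position-↑ˡ b)) (AS-vv G (vertex a) (vertex b))))
                   (ℤₚ.+-identityʳ _)

  scaled-zero-sub : ∀ y t → y * 0ℤ - t ≡ - t
  scaled-zero-sub = solve-∀

  N-ve : ∀ a e → N (a ↑ˡ m G) (k ↑ʳ e) ≡ - [ incident G (vertex a) e ]
  N-ve a e = trans (cong₂ (λ c t → x * c - t) (I-off (↑ˡ≢↑ʳ a e))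
                     (trans (cong₂ (AS G) (position-↑ˡ a) (position-↑ʳ e)) (AS-ve G (vertex a) e)))
                   (scaled-zero-sub x _)

  N-ev : ∀ e b → N (k ↑ʳ e) (b ↑ˡ m G) ≡ - [ incident G (vertex b) e ]
  N-ev e b = trans (cong₂ (λ c t → x * c - t) (I-off (↑ˡ≢↑ʳ b e ∘ sym))
                     (trans (cong₂ (AS G) (position-↑ʳ e) (position-↑ˡ b)) (AS-ev G e (vertex b))))
                   (scaled-zero-sub x _)

  N-ee : ∀ e f → N (k ↑ʳ e) (k ↑ʳ f) ≡ x * I (m G) e f
  N-ee e f = trans (cong₂ (λ c t → x * c - t) (I-↑ʳ k e f)
                     (trans (cong₂ (AS G) (position-↑ʳ e) (position-↑ʳ f)) (AS-ee G e f)))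
                   (ℤₚ.+-identityʳ _)

  schurComplement-Q : ∀ a b → schurComplement k (m G) x N a b ≡ x ^ 2 * I k a b - QGW G W a b
  schurComplement-Q a b = begin
    x * N (a ↑ˡ m G) (b ↑ˡ m G) - ∑[ e < m G ] (N (a ↑ˡ m G) (k ↑ʳ e) * N (k ↑ʳ e) (b ↑ˡ m G))
      ≡⟨ cong₂ (λ c s → x * c - s) (N-vv a b)
           (sum-cong-≗ (λ e → trans (cong₂ _*_ (N-ve a e) (N-ev e b))
                                    (neg*neg [ incident G (vertex a) e ] [ incident G (vertex b) e ]))) ⟩
    x * (x * I k a b) - ∑[ e < m G ] ([ incident G (vertex a) e ] * [ incident G (vertex b) e ])
      ≡⟨ cong₂ _-_ (square x (I k a b)) (Q-incidence G (vertex a) (vertex b)) ⟨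
    x ^ 2 * I k a b - Q G (vertex a) (vertex b) ∎
    where
    open ≡-Reasoning
    neg*neg : ∀ s t → - s * - t ≡ s * t
    neg*neg = solve-∀
    -- x ^ 2 unfolds to x * (x * 1ℤ); the solver is given that form.
    square : ∀ x c → x * (x * 1ℤ) * c ≡ x * (x * c)
    square = solve-∀

lemma4p1 : (G : Graph) (W : Subset (n G)) (x : ℤ) →
    (x ^ (n G ∸ ∣ W ∣)) * φ (length (keepS G W)) (ASW G W) x
    ≡ (x ^ m G) * φ (length (keep W)) (QGW G W) (x ^ 2)
lemma4p1 G W x = begin
  x ^ (n G ∸ ∣ W ∣) * φ (length (keepS G W)) (ASW G W) x
    ≡⟨ cong₂ _*_ (cong (x ^_) (sym (length-keep W))) (φ-cast (sym length-keepS) (ASW G W) x) ⟩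
  x ^ k * det (k ℕ.+ m G) N
    ≡⟨ det-schur k (m G) x N N-ee ⟩
  x ^ m G * det k (schurComplement k (m G) x N)
    ≡⟨ cong (x ^ m G *_) (det-cong k schurComplement-Q) ⟩
  x ^ m G * φ k (QGW G W) (x ^ 2) ∎
  where
  open ≡-Reasoning
  open SubdivisionBlocks G W x
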